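{- Let $G(X,Y)$ be a bipartite graph with $|X|=k$, $|Y|=n$ which does not have NMP. Then: (i) if $T\subseteq Y$ witnesses the violation of NMP for $G(Y,X)$, i.e. $\frac{|N(T)|}{|X|}<\frac{|T|}{|Y|}$, then $X\setminus N(T)$ witnesses the violation of NMP for $G(X,Y)$, i.e. $\frac{|N(X\setminus N(T))|}{|Y|}<\frac{|X\setminus N(T)|}{|X|}$; (ii) either there exists $S\subseteq X$ with $|S|\le \frac{k}{2}$ and $\frac{|N(S)|}{|Y|}<\frac{|S|}{|X|}$, or there exists $T\subseteq Y$ with $|T|<\frac{n}{2}+\frac{n}{k}$ and $\frac{|N(T)|}{|X|}<\frac{|T|}{|Y|}$.
   Context: For a bipartite graph with vertex classes $X,Y$ and a set $S$ of vertices on one side, $N(S)$ denotes the set of vertices on the other side adjacent to some vertex of $S$. $G(X,Y)$ has NMP if $\frac{|N(S)|}{|Y|}\ge\frac{|S|}{|X|}$ for all $S\subseteq X$; $G(Y,X)$ denotes the same graph with the roles of $X$ and $Y$ swapped. A set $S\subseteq X$ witnesses the violation of NMP for $G(X,Y)$ if $\frac{|N(S)|}{|Y|}<\frac{|S|}{|X|}$. -}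

module Defs where

open import Data.Nat using (ℕ; _*_; _+_; _<_; _≤_)
open import Data.Bool using (Bool; true; false; _∧_)
open import Data.Fin using (Fin)
open import Data.Fin.Subset using (Subset; ∣_∣; _∈_; ∁)
open import Data.Vec using (tabulate; lookup)

open import Relation.Nullary using (¬_)
open import Data.Bool.ListAction using (or)
open import Data.List using (map)



-- A bipartite graph G(X,Y) with X = Fin k, Y = Fin n, given by its
-- (decidable) adjacency relation: adj x y = true iff x ~ y.
BipGraph : ℕ → ℕ → Set
BipGraph k n = Fin k → Fin n → Bool

swap : ∀ {k n} → BipGraph k n → BipGraph n k
swap G y x = G x y

open import Data.List using (List)
open import Data.List using () renaming (allFin to allFinL)

N : ∀ {k n} → BipGraph k n → Subset k → Subset n
N {k} G S = tabulate λ y → or (map (λ x → lookup S x ∧ G x y) (allFinL k))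

-- S ⊆ X witnesses violation of NMP for G(X,Y):  |N(S)|/|Y| < |S|/|X|,
-- written with cleared denominators (|X| = k > 0, |Y| = n > 0):
-- |N(S)| * k < |S| * n.
Violates : ∀ {k n} → BipGraph k n → Subset k → Set
Violates {k} {n} G S = ∣ N G S ∣ * k < ∣ S ∣ * n

HasNMP : ∀ {k n} → BipGraph k n → Set
HasNMP {k} G = (S : Subset k) → ¬ Violates G S

-- If T ⊆ Y violates NMP for G(Y,X), the non-neighbours S = X ∖ N(T) of T have
-- N(S) ⊆ Y ∖ T, and passing to complements flips the ratio inequality; the same
-- duality applied to G(Y,X) turns a violator S ⊆ X into the violator Y ∖ N(S).
-- For (ii), shrink a violator S one point at a time while it keeps violating.
-- Either it becomes small, or S − x no longer violates for some x, so
-- |N(S)| ≥ |N(S − x)| ≥ (|S| − 1) n/k with |S| > k/2; then T = Y ∖ N(S) has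
-- |T| ≤ n − (|S| − 1) n/k < n/2 + n/k.
module Submission where

open import Defs
open import Data.Nat using (ℕ; _*_; _+_; _<_; _≤_; NonZero)
open import Data.Fin.Subset using (Subset; ∣_∣; ∁)
open import Data.Product using (Σ; _×_; ∃)
open import Data.Sum using (_⊎_)
open import Relation.Nullary using (¬_)

open import Data.Bool using (T; _∧_)
open import Data.Bool.ListAction using (any)
open import Data.Bool.Properties using (T-∧; T-≡)
open import Data.Empty using (⊥-elim)
open import Data.Fin using (zero; suc)
open import Data.Fin.Subset using (_∈_; _⊆_; _⊂_; _-_; Nonempty; inside; outside)
open import Data.Fin.Subset.Induction using (⊂-wellFounded; Acc; acc)
open import Data.Fin.Subset.Properties
  using (x∉p⇒x∈∁p; x∈∁p⇒x∉p; ∣∁p∣≡n∸∣p∣; ∣p∣≤n; p⊆q⇒∣p∣≤∣q∣; p─⊥≡p; ∣⊥∣≡0;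
         nonempty?; Empty-unique; anySubset?; x∈p⇒p-x⊂p)
open import Data.List using () renaming (allFin to allFinL)
open import Data.List.Membership.Propositional using (lose)
open import Data.List.Membership.Propositional.Properties using (∈-allFin)
open import Data.List.Relation.Unary.Any using (satisfied)
open import Data.List.Relation.Unary.Any.Properties using (any⁺; any⁻)
open import Data.Nat using (suc; _≤?_; _<?_; >-nonZero⁻¹)
open import Data.Nat.Properties
open import Data.Nat.Tactic.RingSolver using (solve-∀)
open import Data.Product using (_,_; proj₁; proj₂)
open import Data.Sum using (inj₁; inj₂)
open import Data.Vec using (_∷_; lookup; here; there)
open import Data.Vec.Properties using (lookup∘tabulate; []=⇒lookup; lookup⇒[]=)
open import Function using (_∘_; Equivalence)
open import Relation.Binary.PropositionalEquality using (_≡_; refl; sym; trans; cong; subst)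
open import Relation.Nullary using (Dec; yes; no)

open Equivalence using (to; from)

∣∁p∣+∣p∣≡n : ∀ {n} (p : Subset n) → ∣ ∁ p ∣ + ∣ p ∣ ≡ n
∣∁p∣+∣p∣≡n p = trans (cong (_+ ∣ p ∣) (∣∁p∣≡n∸∣p∣ p)) (m∸n+n≡m (∣p∣≤n p))

∁-flips-ratio-< : ∀ {l m} (p : Subset m) (q : Subset l) → ∣ q ∣ * m < ∣ p ∣ * l → ∣ ∁ p ∣ * l < ∣ ∁ q ∣ * m
∁-flips-ratio-< {l} {m} p q q*m<p*l = +-cancelʳ-< (∣ p ∣ * l) (∣ ∁ p ∣ * l) (∣ ∁ q ∣ * m) (begin-strict
    ∣ ∁ p ∣ * l + ∣ p ∣ * l    ≡⟨ *-distribʳ-+ l (∣ ∁ p ∣) (∣ p ∣) ⟨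
    (∣ ∁ p ∣ + ∣ p ∣) * l      ≡⟨ cong (_* l) (∣∁p∣+∣p∣≡n p) ⟩
    m * l                      ≡⟨ *-comm m l ⟩
    l * m                      ≡⟨ cong (_* m) (∣∁p∣+∣p∣≡n q) ⟨
    (∣ ∁ q ∣ + ∣ q ∣) * m      ≡⟨ *-distribʳ-+ m (∣ ∁ q ∣) (∣ q ∣) ⟩
    ∣ ∁ q ∣ * m + ∣ q ∣ * m    <⟨ +-monoʳ-< (∣ ∁ q ∣ * m) q*m<p*l ⟩
    ∣ ∁ q ∣ * m + ∣ p ∣ * l    ∎)
  where open ≤-Reasoning

x∈p⇒∣p∣≡1+∣p-x∣ : ∀ {n} {p : Subset n} {x} → x ∈ p → ∣ p ∣ ≡ suc ∣ p - x ∣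
x∈p⇒∣p∣≡1+∣p-x∣ {p = inside ∷ p}  {zero}  here        = cong (suc ∘ ∣_∣) (sym (p─⊥≡p p))
x∈p⇒∣p∣≡1+∣p-x∣ {p = inside ∷ p}  {suc x} (there x∈p) = cong suc (x∈p⇒∣p∣≡1+∣p-x∣ x∈p)
x∈p⇒∣p∣≡1+∣p-x∣ {p = outside ∷ p} {suc x} (there x∈p) = x∈p⇒∣p∣≡1+∣p-x∣ x∈p

-- With t = n − a, a ≥ s n / k and k ≤ 2 s + 1 this says t < n/2 + n/k.
complement-bound : ∀ {k n t a s} → t + a ≡ n → k < 2 * suc s → s * n ≤ a * k → 0 < n →
                   2 * k * t < k * n + 2 * n
complement-bound {k} {_} {t} {a} {s} refl k<2[1+s] s*n≤a*k 0<n =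
  +-cancelʳ-< (2 * (a * k)) (2 * k * t) (k * n + 2 * n) (begin-strict
    2 * k * t + 2 * (a * k)      ≡⟨ double-split k t a ⟩
    k * n + k * n                ≤⟨ +-monoʳ-≤ (k * n) k*n≤n+2*a*k ⟩
    k * n + (n + 2 * (a * k))    <⟨ +-monoʳ-< (k * n) (+-monoˡ-< (2 * (a * k)) n<2*n) ⟩
    k * n + (2 * n + 2 * (a * k)) ≡⟨ +-assoc (k * n) (2 * n) (2 * (a * k)) ⟨
    k * n + 2 * n + 2 * (a * k)  ∎)
  where
  open ≤-Reasoning
  n = t + a
  double-split : ∀ k t a → 2 * k * t + 2 * (a * k) ≡ k * (t + a) + k * (t + a)
  double-split = solve-∀
  odd-split : ∀ s n → suc (2 * s) * n ≡ n + 2 * (s * n)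
  odd-split = solve-∀
  n<2*n : n < 2 * n
  n<2*n = subst (n <_) (cong (n +_) (sym (+-identityʳ n))) (m<m+n n 0<n)
  k*n≤n+2*a*k : k * n ≤ n + 2 * (a * k)
  k*n≤n+2*a*k = begin
    k * n               ≤⟨ *-monoˡ-≤ n (subst (k ≤_) (+-suc s (s + 0)) (≤-pred k<2[1+s])) ⟩
    suc (2 * s) * n     ≡⟨ odd-split s n ⟩
    n + 2 * (s * n)     ≤⟨ +-monoʳ-≤ n (*-monoʳ-≤ 2 s*n≤a*k) ⟩
    n + 2 * (a * k)     ∎

module _ {k n} (G : BipGraph k n) where

  ∈N⇒adjacent : ∀ {S y} → y ∈ N G S → ∃ λ x → x ∈ S × T (G x y)
  ∈N⇒adjacent {S} {y} y∈N
    with satisfied (any⁻ _ (allFinL k) (from T-≡ (trans (sym (lookup∘tabulate _ y)) ([]=⇒lookup y∈N))))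
  ... | x , x∈S∧xy = x , lookup⇒[]= x S (to T-≡ (proj₁ (to T-∧ x∈S∧xy))) , proj₂ (to T-∧ x∈S∧xy)

  adjacent⇒∈N : ∀ {S x y} → x ∈ S → T (G x y) → y ∈ N G S
  adjacent⇒∈N {S} {x} {y} x∈S xy = lookup⇒[]= y (N G S) (trans (lookup∘tabulate _ y) (to T-≡ N[y]))
    where
    N[y] : T (any (λ x → lookup S x ∧ G x y) (allFinL k))
    N[y] = any⁺ _ (lose (∈-allFin x) (from T-∧ (from T-≡ ([]=⇒lookup x∈S) , xy)))

  N-mono : ∀ {S S′} → S′ ⊆ S → N G S′ ⊆ N G S
  N-mono S′⊆S y∈N with ∈N⇒adjacent y∈N
  ... | x , x∈S′ , xy = adjacent⇒∈N (S′⊆S x∈S′) xy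

module _ {k n} (G : BipGraph k n) where

  N∁N⊆∁ : ∀ T → N G (∁ (N (swap G) T)) ⊆ ∁ T
  N∁N⊆∁ T y∈N with ∈N⇒adjacent G y∈N
  ... | x , x∉NT , xy = x∉p⇒x∈∁p λ y∈T → x∈∁p⇒x∉p x∉NT (adjacent⇒∈N (swap G) y∈T xy)

  violates-∁N : ∀ T → Violates (swap G) T → Violates G (∁ (N (swap G) T))
  violates-∁N T NT-violates = begin-strict
      ∣ N G S ∣ * k  ≤⟨ *-monoˡ-≤ k (p⊆q⇒∣p∣≤∣q∣ (N∁N⊆∁ T)) ⟩
      ∣ ∁ T ∣ * k    <⟨ ∁-flips-ratio-< T (N (swap G) T) NT-violates ⟩
      ∣ S ∣ * n      ∎
    where open ≤-Reasoning
          S = ∁ (N (swap G) T)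

module _ {k n} (G : BipGraph k n) where

  violates? : ∀ S → Dec (Violates G S)
  violates? S = ∣ N G S ∣ * k <? ∣ S ∣ * n

  ¬NMP⇒violator : ¬ HasNMP G → ∃ (Violates G)
  ¬NMP⇒violator ¬nmp with anySubset? violates?
  ... | yes violator = violator
  ... | no ∄violator = ⊥-elim (¬nmp λ S v → ∄violator (S , v))

  violator-nonempty : ∀ {S} → Violates G S → Nonempty S
  violator-nonempty {S} v with nonempty? S
  ... | yes nonempty = nonempty
  ... | no empty = ⊥-elim (n≮0 (subst (λ s → ∣ N G S ∣ * k < s * n) ∣S∣≡0 v))
    where ∣S∣≡0 = trans (cong ∣_∣ (Empty-unique empty)) (∣⊥∣≡0 k)

  small-or-dual-violator : 0 < n → ∀ S → Acc _⊂_ S → Violates G S →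
    (Σ (Subset k) λ S → (2 * ∣ S ∣ ≤ k) × Violates G S)
    ⊎ (Σ (Subset n) λ T → (2 * k * ∣ T ∣ < k * n + 2 * n) × Violates (swap G) T)
  small-or-dual-violator 0<n S (acc rec) v with 2 * ∣ S ∣ ≤? k | violator-nonempty v
  ... | yes small | _ = inj₁ (S , small , v)
  ... | no large | x , x∈S with violates? (S - x)
  ...   | yes v′ = small-or-dual-violator 0<n (S - x) (rec (x∈p⇒p-x⊂p x∈S)) v′
  ...   | no ¬v′ = inj₂ (∁ (N G S) , bound , violates-∁N (swap G) S v)
    where
    k<2[1+s] : k < 2 * suc ∣ S - x ∣
    k<2[1+s] = subst (λ s → k < 2 * s) (x∈p⇒∣p∣≡1+∣p-x∣ x∈S) (≰⇒> large)
    s*n≤a*k : ∣ S - x ∣ * n ≤ ∣ N G S ∣ * k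
    s*n≤a*k = ≤-trans (≮⇒≥ ¬v′) (*-monoˡ-≤ k (p⊆q⇒∣p∣≤∣q∣ (N-mono G (proj₁ (x∈p⇒p-x⊂p x∈S)))))
    bound : 2 * k * ∣ ∁ (N G S) ∣ < k * n + 2 * n
    bound = complement-bound (∣∁p∣+∣p∣≡n (N G S)) k<2[1+s] s*n≤a*k 0<n

lemma2p2 : (k n : ℕ) → .{{_ : NonZero k}} → .{{_ : NonZero n}} →
    (G : BipGraph k n) → ¬ HasNMP G →
    ((T : Subset n) → Violates (swap G) T → Violates G (∁ (N (swap G) T)))
    × ((Σ (Subset k) λ S → (2 * ∣ S ∣ ≤ k) × Violates G S)
       ⊎ (Σ (Subset n) λ T → (2 * k * ∣ T ∣ < k * n + 2 * n) × Violates (swap G) T))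
lemma2p2 k n G ¬nmp =
  violates-∁N G , small-or-dual-violator G (>-nonZero⁻¹ n) S (⊂-wellFounded S) v
  where
  S = proj₁ (¬NMP⇒violator G ¬nmp)
  v = proj₂ (¬NMP⇒violator G ¬nmp)
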